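{- Let $m\in\mathbb{N}$ be odd, $x,y>0$ real, $p\in\mathbb{R}$, $n\in\mathbb{N}_0$ and $\lambda\in\mathbb{C}$. Then $$G_{n}(mx,py;\lambda)=m^{n-1}\sum_{k=0}^{m-1}\lambda^{k}(-1)^{k}\,{}_{H}G_{n}\Big(x+\frac{k}{m},\frac{py}{m^{2}};\lambda^{m}\Big).$$
   Context: The Apostol-Genocchi polynomials are defined by $\frac{2te^{xt}}{\lambda e^{t}+1}=\sum_{n\ge0}G_{n}(x;\lambda)\frac{t^{n}}{n!}$. The 2-variable Apostol-Genocchi polynomials are defined by $\frac{2t\,e^{xt+yt^{2}}}{\lambda e^{t}+1}=\sum_{n\ge0}G_{n}(x,y;\lambda)\frac{t^{n}}{n!}$. Further, ${}_{H}G_{n}(x,y;\lambda)=n!\sum_{s=0}^{\lfloor n/2\rfloor}\frac{y^{s}G_{n-2s}(x;\lambda)}{s!(n-2s)!}$. -}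

module Defs where

open import Level using (Level; _⊔_)
open import Algebra.Bundles using (CommutativeRing)
open import Data.Nat as ℕ using (ℕ; zero; suc; _∸_; _!; ⌊_/2⌋)
open import Data.Product using (∃)
open import Relation.Nullary using (¬_)
open import Relation.Binary.PropositionalEquality using (_≡_)

natι : ∀ {c ℓ} (R : CommutativeRing c ℓ) → ℕ → CommutativeRing.Carrier R
natι R zero    = CommutativeRing.0# R
natι R (suc n) = CommutativeRing._+_ R (CommutativeRing.1# R) (natι R n)

-- A field of characteristic zero: a commutative ring with a (total) inverse
-- operation that is a genuine inverse on non-zero elements, 1 ≠ 0, and
-- n·1 ≠ 0 for every n ≥ 1.  (ℂ is the instance relevant to the paper.)
record Char0Field (c ℓ : Level) : Set (Level.suc (c ⊔ ℓ)) where
  field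
    commRing : CommutativeRing c ℓ
  open CommutativeRing commRing public
  field
    _⁻¹     : Carrier → Carrier
    inverse : ∀ x → ¬ (x ≈ 0#) → x * (x ⁻¹) ≈ 1#

    char0   : ∀ n → ¬ (natι commRing (suc n) ≈ 0#)

  ι : ℕ → Carrier
  ι = natι commRing

Odd : ℕ → Set
Odd m = ∃ λ k → m ≡ suc (2 ℕ.* k)

module Over {c ℓ} (F : Char0Field c ℓ) where
  open Char0Field F hiding (zero)

  _^_ : Carrier → ℕ → Carrier
  x ^ zero  = 1#
  x ^ suc n = x * (x ^ n)

  sumTo : ℕ → (ℕ → Carrier) → Carrier
  sumTo zero    f = 0#
  sumTo (suc n) f = sumTo n f + f n

  invFact : ℕ → Carrier
  invFact n = ι (n !) ⁻¹

  -- formal power series in t, given by their coefficient of t^n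
  Series : Set c
  Series = ℕ → Carrier

  _⊛_ : Series → Series → Series
  (f ⊛ g) n = sumTo (suc n) (λ k → f k * g (n ∸ k))

  _⊕_ : Series → Series → Series
  (f ⊕ g) n = f n + g n

  scale : Carrier → Series → Series
  scale a f n = a * f n

  one : Series
  one zero    = 1#
  one (suc _) = 0#

  shiftT : Series → Series
  shiftT f zero    = 0#
  shiftT f (suc n) = f n

  -- substitution t ↦ t² :  (sub2 f) (2k) = f k,  (sub2 f) (2k+1) = 0
  sub2 : Series → Series
  sub2 f zero          = f zero
  sub2 f (suc zero)    = 0#
  sub2 f (suc (suc n)) = sub2 (λ k → f (suc k)) n

  expS : Carrier → Series
  expS a n = (a ^ n) * invFact n

  egf : (ℕ → Carrier) → Series
  egf g n = g n * invFact n

  den : Carrier → Series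
  den λ' = scale λ' (expS 1#) ⊕ one

  -- g is the Apostol–Genocchi sequence G_n(x;λ):
  --   2t e^{xt} / (λ e^t + 1) = Σ g_n t^n/n!,
  -- stated (division-free) as (λ e^t + 1) · Σ g_n t^n/n! = 2t e^{xt}.
  IsAG : Carrier → Carrier → (ℕ → Carrier) → Set ℓ
  IsAG x λ' g = ∀ n → (den λ' ⊛ egf g) n ≈ scale (ι 2) (shiftT (expS x)) n

  -- g is the 2-variable Apostol–Genocchi sequence G_n(x,y;λ):
  --   (λ e^t + 1) · Σ g_n t^n/n! = 2t e^{xt} e^{yt²}.
  IsAG2 : Carrier → Carrier → Carrier → (ℕ → Carrier) → Set ℓ
  IsAG2 x y λ' g = ∀ n →
    (den λ' ⊛ egf g) n ≈ scale (ι 2) (shiftT (expS x ⊛ sub2 (expS y))) n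

  HG : (Carrier → Carrier → ℕ → Carrier) → Carrier → Carrier → Carrier → ℕ → Carrier
  HG G x y λ' n =
    ι (n !) * sumTo (suc ⌊ n /2⌋)
      (λ s → (y ^ s) * G x λ' (n ∸ 2 ℕ.* s) * (ι (s ! ℕ.* (n ∸ 2 ℕ.* s) !) ⁻¹))

  -- m^{n-1}, with m^{-1} = 1/m when n = 0
  mPow : ℕ → ℕ → Carrier
  mPow m zero    = ι m ⁻¹
  mPow m (suc k) = ι m ^ k

-- Sequences are handled through their exponential generating functions, i.e.
-- formal power series over a field of characteristic zero.  Then: _H G satisfies the defining equation of G(x,y;λ);
-- for odd m, (Σ_{k<m} (-λ)^k e^{kt}) (λe^t + 1) = λ^m e^{mt} + 1 (telescoping);
-- and λ^m e^{mt} + 1 is cancellable, since multiplied by the dilated generating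
-- function of G_n(0;λ^m) it gives 2mt.  Both sides of the theorem, as dilated
-- generating functions, become m (Σ_k (-λ)^k e^{kt}) 2t e^{mxt + pyt²} after
-- multiplication by λ^m e^{mt} + 1; cancel it and compare coefficients.
module Submission where

open import Defs
open import Data.Nat using (ℕ; suc)
open import Data.Nat as ℕ using (zero; _<_; _∸_; _!; ⌊_/2⌋; NonZero)
import Data.Nat.Properties as ℕP
open import Data.Product using (_,_)
open import Data.Maybe using (nothing)
open import Relation.Nullary using (¬_)
open import Relation.Binary.PropositionalEquality as ≡ using (_≡_)
import Relation.Binary.Reasoning.Setoid as SetoidReasoning
import Algebra.Properties.Ring as RingProperties

module Proof {c ℓ} (F : Char0Field c ℓ) where
  open Char0Field F hiding (zero)
  open Over F
  open SetoidReasoning setoid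

  open RingProperties ring using (-1*x≈-x; -‿involutive; -‿distribˡ-*; -‿distribʳ-*)

  open import Algebra.Solver.Ring.NaturalCoefficients commutativeSemiring (λ _ _ → nothing)
    using (solve; _:=_; _:+_; _:*_; con)

  ≡-index : (h : ℕ → Carrier) → ∀ {i j} → i ≡ j → h i ≈ h j
  ≡-index h ≡.refl = refl

  ι-+ : ∀ a b → ι (a ℕ.+ b) ≈ ι a + ι b
  ι-+ zero    b = sym (+-identityˡ _)
  ι-+ (suc a) b = trans (+-cong refl (ι-+ a b)) (sym (+-assoc _ _ _))

  ι-* : ∀ a b → ι (a ℕ.* b) ≈ ι a * ι b
  ι-* zero    b = sym (zeroˡ _)
  ι-* (suc a) b = begin
    ι (b ℕ.+ a ℕ.* b)  ≈⟨ ι-+ b (a ℕ.* b) ⟩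
    ι b + ι (a ℕ.* b)  ≈⟨ +-cong refl (ι-* a b) ⟩
    ι b + ι a * ι b    ≈⟨ +-cong (sym (*-identityˡ _)) refl ⟩
    1# * ι b + ι a * ι b ≈⟨ sym (distribʳ _ _ _) ⟩
    (1# + ι a) * ι b   ∎

  ι-one : ι 1 ≈ 1#
  ι-one = +-identityʳ 1#

  pow-cong : ∀ {a b} n → a ≈ b → a ^ n ≈ b ^ n
  pow-cong zero    a≈b = refl
  pow-cong (suc n) a≈b = *-cong a≈b (pow-cong n a≈b)

  pow-+ : ∀ a i j → a ^ (i ℕ.+ j) ≈ a ^ i * a ^ j
  pow-+ a zero    j = sym (*-identityˡ _)
  pow-+ a (suc i) j = trans (*-cong refl (pow-+ a i j)) (sym (*-assoc _ _ _))

  pow-* : ∀ a b n → (a * b) ^ n ≈ a ^ n * b ^ n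
  pow-* a b zero    = sym (*-identityˡ _)
  pow-* a b (suc n) = trans (*-cong refl (pow-* a b n))
    (solve 4 (λ u v w z → (u :* v) :* (w :* z) := (u :* w) :* (v :* z)) refl a b (a ^ n) (b ^ n))

  minus-one-even : ∀ j → (- 1#) ^ (2 ℕ.* j) ≈ 1#
  minus-one-even zero    = refl
  minus-one-even (suc j) = begin
    (- 1#) ^ (2 ℕ.* suc j)             ≈⟨ ≡-index ((- 1#) ^_) (≡.cong suc (ℕP.+-suc j (j ℕ.+ 0))) ⟩
    - 1# * (- 1# * (- 1#) ^ (2 ℕ.* j)) ≈⟨ trans (-1*x≈-x _) (trans (-‿cong (-1*x≈-x _)) (-‿involutive _)) ⟩
    (- 1#) ^ (2 ℕ.* j)                 ≈⟨ minus-one-even j ⟩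
    1#                                 ∎

  minus-one-odd : ∀ {m} → Odd m → (- 1#) ^ m ≈ - 1#
  minus-one-odd (j , ≡.refl) = trans (*-cong refl (minus-one-even j)) (*-identityʳ _)

  1≉0 : ¬ (1# ≈ 0#)
  1≉0 1≈0 = char0 0 (trans ι-one 1≈0)

  cancelˡ : ∀ {a x y} → ¬ (a ≈ 0#) → a * x ≈ a * y → x ≈ y
  cancelˡ {a} {x} {y} a≉0 ax≈ay = begin
    x                ≈⟨ sym (*-identityˡ x) ⟩
    1# * x           ≈⟨ *-cong (sym (trans (*-comm _ _) (inverse a a≉0))) refl ⟩
    (a ⁻¹ * a) * x   ≈⟨ *-assoc _ _ _ ⟩
    a ⁻¹ * (a * x)   ≈⟨ *-cong refl ax≈ay ⟩
    a ⁻¹ * (a * y)   ≈⟨ sym (*-assoc _ _ _) ⟩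
    (a ⁻¹ * a) * y   ≈⟨ *-cong (trans (*-comm _ _) (inverse a a≉0)) refl ⟩
    1# * y           ≈⟨ *-identityˡ y ⟩
    y                ∎

  nonzero-* : ∀ {a b} → ¬ (a ≈ 0#) → ¬ (b ≈ 0#) → ¬ (a * b ≈ 0#)
  nonzero-* {a} {b} a≉0 b≉0 ab≈0 = b≉0 (cancelˡ a≉0 (trans ab≈0 (sym (zeroʳ a))))

  inverse-unique : ∀ {x y} → ¬ (x ≈ 0#) → x * y ≈ 1# → x ⁻¹ ≈ y
  inverse-unique {x} x≉0 xy≈1 = cancelˡ x≉0 (trans (inverse x x≉0) (sym xy≈1))

  ι-nonzero : ∀ n → .{{NonZero n}} → ¬ (ι n ≈ 0#)
  ι-nonzero (suc n) = char0 n

  odd-nonzero : ∀ {m} → Odd m → ¬ (ι m ≈ 0#)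
  odd-nonzero (j , ≡.refl) = char0 (2 ℕ.* j)

  invFact-inverse : ∀ n → ι (n !) * invFact n ≈ 1#
  invFact-inverse n = inverse _ (ι-nonzero (n !) {{ℕP._!≢0 n}})

  invFact-nonzero : ∀ n → ¬ (invFact n ≈ 0#)
  invFact-nonzero n inv≈0 = 1≉0 (trans (sym (invFact-inverse n)) (trans (*-cong refl inv≈0) (zeroʳ _)))

  invFact-zero : invFact 0 ≈ 1#
  invFact-zero = inverse-unique (ι-nonzero 1) (trans (*-identityʳ _) ι-one)

  invFact-suc : ∀ n → ι (suc n) * invFact (suc n) ≈ invFact n
  invFact-suc n = cancelˡ (ι-nonzero (n !) {{ℕP._!≢0 n}}) (begin
    ι (n !) * (ι (suc n) * invFact (suc n))  ≈⟨ sym (*-assoc _ _ _) ⟩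
    (ι (n !) * ι (suc n)) * invFact (suc n)  ≈⟨ *-cong (trans (*-comm _ _) (sym (ι-* (suc n) (n !)))) refl ⟩
    ι (suc n !) * invFact (suc n)            ≈⟨ invFact-inverse (suc n) ⟩
    1#                                       ≈⟨ sym (invFact-inverse n) ⟩
    ι (n !) * invFact n                      ∎)

  invFact-product : ∀ a b → ι (a ! ℕ.* b !) ⁻¹ ≈ invFact a * invFact b
  invFact-product a b = inverse-unique (ι-nonzero _ {{ℕP._!*_!≢0 a b}}) (begin
    ι (a ! ℕ.* b !) * (invFact a * invFact b)    ≈⟨ *-cong (ι-* (a !) (b !)) refl ⟩
    (ι (a !) * ι (b !)) * (invFact a * invFact b)
      ≈⟨ solve 4 (λ u v w z → (u :* v) :* (w :* z) := (u :* w) :* (v :* z)) refl _ _ _ _ ⟩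
    (ι (a !) * invFact a) * (ι (b !) * invFact b) ≈⟨ *-cong (invFact-inverse a) (invFact-inverse b) ⟩
    1# * 1#                                      ≈⟨ *-identityˡ _ ⟩
    1#                                           ∎)

  sum-cong< : ∀ n {f g : ℕ → Carrier} → (∀ k → k < n → f k ≈ g k) → sumTo n f ≈ sumTo n g
  sum-cong< zero    f≈g = refl
  sum-cong< (suc n) f≈g = +-cong (sum-cong< n (λ k k<n → f≈g k (ℕP.m<n⇒m<1+n k<n))) (f≈g n ℕP.≤-refl)

  sum-cong : ∀ n {f g : ℕ → Carrier} → (∀ k → f k ≈ g k) → sumTo n f ≈ sumTo n g
  sum-cong n f≈g = sum-cong< n (λ k _ → f≈g k)

  sum-0 : ∀ n → sumTo n (λ _ → 0#) ≈ 0#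
  sum-0 zero    = refl
  sum-0 (suc n) = trans (+-identityʳ _) (sum-0 n)

  sum-+ : ∀ n (f g : ℕ → Carrier) → sumTo n (λ k → f k + g k) ≈ sumTo n f + sumTo n g
  sum-+ zero    f g = sym (+-identityˡ _)
  sum-+ (suc n) f g = trans (+-cong (sum-+ n f g) refl)
    (solve 4 (λ a b c d → (a :+ b) :+ (c :+ d) := (a :+ c) :+ (b :+ d)) refl _ _ _ _)

  sum-*ˡ : ∀ n a (f : ℕ → Carrier) → a * sumTo n f ≈ sumTo n (λ k → a * f k)
  sum-*ˡ zero    a f = zeroʳ a
  sum-*ˡ (suc n) a f = trans (distribˡ _ _ _) (+-cong (sum-*ˡ n a f) refl)

  sum-*ʳ : ∀ n a (f : ℕ → Carrier) → sumTo n f * a ≈ sumTo n (λ k → f k * a)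
  sum-*ʳ n a f = trans (*-comm _ _) (trans (sum-*ˡ n a f) (sum-cong n (λ k → *-comm _ _)))

  sum-peel : ∀ n (f : ℕ → Carrier) → sumTo (suc n) f ≈ f 0 + sumTo n (λ k → f (suc k))
  sum-peel zero    f = trans (+-identityˡ _) (sym (+-identityʳ _))
  sum-peel (suc n) f = trans (+-cong (sum-peel n f) refl) (+-assoc _ _ _)

  sum-reverse : ∀ n (f : ℕ → Carrier) → sumTo n f ≈ sumTo n (λ k → f (n ∸ suc k))
  sum-reverse zero    f = refl
  sum-reverse (suc n) f = begin
    sumTo n f + f n                        ≈⟨ +-cong (sum-reverse n f) refl ⟩
    sumTo n (λ k → f (n ∸ suc k)) + f n    ≈⟨ +-comm _ _ ⟩
    f n + sumTo n (λ k → f (n ∸ suc k))    ≈⟨ sym (sum-peel n (λ k → f (n ∸ k))) ⟩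
    sumTo (suc n) (λ k → f (n ∸ k))        ∎

  sum-swap : ∀ a b (A : ℕ → ℕ → Carrier) →
    sumTo a (λ i → sumTo b (λ j → A i j)) ≈ sumTo b (λ j → sumTo a (λ i → A i j))
  sum-swap zero    b A = sym (sum-0 b)
  sum-swap (suc a) b A = trans (+-cong (sum-swap a b A) refl)
    (sym (sum-+ b (λ j → sumTo a (λ i → A i j)) (λ j → A a j)))

  sum-triangle : ∀ n (A : ℕ → ℕ → Carrier) →
    sumTo (suc n) (λ k → sumTo (suc k) (λ i → A i k))
      ≈ sumTo (suc n) (λ i → sumTo (suc (n ∸ i)) (λ j → A i (i ℕ.+ j)))
  sum-triangle zero    A = refl
  sum-triangle (suc n) A = begin
    sumTo (suc (suc n)) (λ k → sumTo (suc k) (λ i → A i k))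
      ≈⟨ sum-peel (suc n) _ ⟩
    (0# + A 0 0) + sumTo (suc n) (λ k → sumTo (suc (suc k)) (λ i → A i (suc k)))
      ≈⟨ +-cong (+-identityˡ _) (sum-cong (suc n) (λ k → sum-peel (suc k) _)) ⟩
    A 0 0 + sumTo (suc n) (λ k → A 0 (suc k) + sumTo (suc k) (λ i → A (suc i) (suc k)))
      ≈⟨ +-cong refl (sum-+ (suc n) _ _) ⟩
    A 0 0 + (first-row + sumTo (suc n) (λ k → sumTo (suc k) (λ i → A (suc i) (suc k))))
      ≈⟨ +-cong refl (+-cong refl (sum-triangle n (λ i k → A (suc i) (suc k)))) ⟩
    A 0 0 + (first-row + sumTo (suc n) (λ i → sumTo (suc (n ∸ i)) (λ j → A (suc i) (suc (i ℕ.+ j)))))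
      ≈⟨ sym (+-assoc _ _ _) ⟩
    (A 0 0 + first-row) + sumTo (suc n) (λ i → sumTo (suc (n ∸ i)) (λ j → A (suc i) (suc (i ℕ.+ j))))
      ≈⟨ +-cong (sym (sum-peel (suc n) (A 0))) refl ⟩
    sumTo (suc (suc n)) (A 0) + sumTo (suc n) (λ i → sumTo (suc (n ∸ i)) (λ j → A (suc i) (suc (i ℕ.+ j))))
      ≈⟨ sym (sum-peel (suc n) _) ⟩
    sumTo (suc (suc n)) (λ i → sumTo (suc (suc n ∸ i)) (λ j → A i (i ℕ.+ j))) ∎
    where
    first-row : Carrier
    first-row = sumTo (suc n) (λ k → A 0 (suc k))

  telescope : ∀ m (a b : ℕ → Carrier) → (∀ k → b k + a (suc k) ≈ 0#) →
              sumTo m (λ k → b k + a k) + a m ≈ a 0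
  telescope zero    a b cancels = +-identityˡ _
  telescope (suc m) a b cancels = begin
    (sumTo m (λ k → b k + a k) + (b m + a m)) + a (suc m)
      ≈⟨ solve 4 (λ S u v w → (S :+ (u :+ v)) :+ w := (S :+ v) :+ (u :+ w)) refl _ _ _ _ ⟩
    (sumTo m (λ k → b k + a k) + a m) + (b m + a (suc m)) ≈⟨ +-cong (telescope m a b cancels) (cancels m) ⟩
    a 0 + 0#                                            ≈⟨ +-identityʳ _ ⟩
    a 0                                                 ∎

  infix 4 _≋_
  _≋_ : Series → Series → Set ℓ
  f ≋ g = ∀ n → f n ≈ g n

  ≋-refl : ∀ {f} → f ≋ f
  ≋-refl n = refl

  ≋-sym : ∀ {f g} → f ≋ g → g ≋ f
  ≋-sym f≋g n = sym (f≋g n)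

  ≋-trans : ∀ {f g h} → f ≋ g → g ≋ h → f ≋ h
  ≋-trans f≋g g≋h n = trans (f≋g n) (g≋h n)

  infixr 2 _≋⟨_⟩_
  infix  3 _≋∎
  _≋⟨_⟩_ : ∀ (f : Series) {g h} → f ≋ g → g ≋ h → f ≋ h
  f ≋⟨ f≋g ⟩ g≋h = ≋-trans f≋g g≋h

  _≋∎ : ∀ (f : Series) → f ≋ f
  f ≋∎ = ≋-refl

  ⊛-cong : ∀ {f f′ g g′} → f ≋ f′ → g ≋ g′ → (f ⊛ g) ≋ (f′ ⊛ g′)
  ⊛-cong f≋f′ g≋g′ n = sum-cong (suc n) (λ k → *-cong (f≋f′ k) (g≋g′ (n ∸ k)))

  ⊛-congˡ : ∀ {f f′} g → f ≋ f′ → (f ⊛ g) ≋ (f′ ⊛ g)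
  ⊛-congˡ g f≋f′ = ⊛-cong f≋f′ (≋-refl {g})

  ⊛-congʳ : ∀ f {g g′} → g ≋ g′ → (f ⊛ g) ≋ (f ⊛ g′)
  ⊛-congʳ f g≋g′ = ⊛-cong (≋-refl {f}) g≋g′

  scale-cong : ∀ {a b f g} → a ≈ b → f ≋ g → scale a f ≋ scale b g
  scale-cong a≈b f≋g n = *-cong a≈b (f≋g n)

  shift-cong : ∀ {f g} → f ≋ g → shiftT f ≋ shiftT g
  shift-cong f≋g zero    = refl
  shift-cong f≋g (suc n) = f≋g n

  ⊛-comm : ∀ f g → (f ⊛ g) ≋ (g ⊛ f)
  ⊛-comm f g n = begin
    sumTo (suc n) (λ k → f k * g (n ∸ k))               ≈⟨ sum-reverse (suc n) _ ⟩
    sumTo (suc n) (λ k → f (n ∸ k) * g (n ∸ (n ∸ k)))   ≈⟨ sum-cong< (suc n) (λ k k≤n →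
      trans (*-comm _ _) (*-cong (≡-index g (ℕP.m∸[m∸n]≡n (ℕP.≤-pred k≤n))) refl)) ⟩
    sumTo (suc n) (λ k → g k * f (n ∸ k))               ∎

  ⊛-assoc : ∀ f g h → ((f ⊛ g) ⊛ h) ≋ (f ⊛ (g ⊛ h))
  ⊛-assoc f g h n = begin
    sumTo (suc n) (λ k → sumTo (suc k) (λ i → f i * g (k ∸ i)) * h (n ∸ k))
      ≈⟨ sum-cong (suc n) (λ k → sum-*ʳ (suc k) _ _) ⟩
    sumTo (suc n) (λ k → sumTo (suc k) (λ i → f i * g (k ∸ i) * h (n ∸ k)))
      ≈⟨ sum-triangle n (λ i k → f i * g (k ∸ i) * h (n ∸ k)) ⟩
    sumTo (suc n) (λ i → sumTo (suc (n ∸ i)) (λ j → f i * g ((i ℕ.+ j) ∸ i) * h (n ∸ (i ℕ.+ j))))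
      ≈⟨ sum-cong (suc n) (λ i → sum-cong (suc (n ∸ i)) (λ j → trans (*-assoc _ _ _)
           (*-cong refl (*-cong (≡-index g (ℕP.m+n∸m≡n i j)) (≡-index h (≡.sym (ℕP.∸-+-assoc n i j))))))) ⟩
    sumTo (suc n) (λ i → sumTo (suc (n ∸ i)) (λ j → f i * (g j * h ((n ∸ i) ∸ j))))
      ≈⟨ sum-cong (suc n) (λ i → sym (sum-*ˡ (suc (n ∸ i)) (f i) _)) ⟩
    (f ⊛ (g ⊛ h)) n ∎

  one-⊛ : ∀ f → (one ⊛ f) ≋ f
  one-⊛ f n = begin
    (one ⊛ f) n                                         ≈⟨ sum-peel n _ ⟩
    1# * f n + sumTo n (λ k → 0# * f (n ∸ suc k))       ≈⟨ +-cong (*-identityˡ _) (trans (sum-cong n (λ k → zeroˡ _)) (sum-0 n)) ⟩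
    f n + 0#                                            ≈⟨ +-identityʳ _ ⟩
    f n                                                 ∎

  ⊛-one : ∀ f → (f ⊛ one) ≋ f
  ⊛-one f = ≋-trans (⊛-comm f one) (one-⊛ f)

  ⊛-⊕ : ∀ f g h → (h ⊛ (f ⊕ g)) ≋ ((h ⊛ f) ⊕ (h ⊛ g))
  ⊛-⊕ f g h n = trans (sum-cong (suc n) (λ k → distribˡ _ _ _)) (sum-+ (suc n) _ _)

  scale-⊛ : ∀ a f g → (scale a f ⊛ g) ≋ scale a (f ⊛ g)
  scale-⊛ a f g n = trans (sum-cong (suc n) (λ k → *-assoc _ _ _)) (sym (sum-*ˡ (suc n) a _))

  ⊛-scale : ∀ a f g → (f ⊛ scale a g) ≋ scale a (f ⊛ g)
  ⊛-scale a f g = ≋-trans (⊛-comm f (scale a g)) (≋-trans (scale-⊛ a g f) (scale-cong refl (⊛-comm g f)))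

  scale-scale : ∀ a b f → scale a (scale b f) ≋ scale (a * b) f
  scale-scale a b f n = sym (*-assoc _ _ _)

  scale-swap : ∀ a b f → scale a (scale b f) ≋ scale b (scale a f)
  scale-swap a b f n = solve 3 (λ u v w → u :* (v :* w) := v :* (u :* w)) refl a b (f n)

  shift-⊛ : ∀ f g → (shiftT f ⊛ g) ≋ shiftT (f ⊛ g)
  shift-⊛ f g zero    = trans (+-identityˡ _) (zeroˡ _)
  shift-⊛ f g (suc n) = trans (sum-peel (suc n) _) (trans (+-cong (zeroˡ _) refl) (+-identityˡ _))

  sumS : ℕ → (ℕ → Series) → Series
  sumS m Fs n = sumTo m (λ k → Fs k n)

  sumS-cong : ∀ m {Fs Gs} → (∀ k → Fs k ≋ Gs k) → sumS m Fs ≋ sumS m Gs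
  sumS-cong m Fs≋Gs n = sum-cong m (λ k → Fs≋Gs k n)

  sumS-⊛ : ∀ m Fs h → (sumS m Fs ⊛ h) ≋ sumS m (λ k → Fs k ⊛ h)
  sumS-⊛ m Fs h n = begin
    sumTo (suc n) (λ j → sumTo m (λ k → Fs k j) * h (n ∸ j))  ≈⟨ sum-cong (suc n) (λ j → sum-*ʳ m _ _) ⟩
    sumTo (suc n) (λ j → sumTo m (λ k → Fs k j * h (n ∸ j)))  ≈⟨ sum-swap (suc n) m _ ⟩
    sumTo m (λ k → sumTo (suc n) (λ j → Fs k j * h (n ∸ j)))  ∎

  sumS-scale : ∀ m a Fs → scale a (sumS m Fs) ≋ sumS m (λ k → scale a (Fs k))
  sumS-scale m a Fs n = sum-*ˡ m a _

  ∂ : Series → Series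
  ∂ f n = ι (suc n) * f (suc n)

  -- Leibniz rule: splitting the weight N = k + (N - k) of each term of (f ⊛ g)_N
  ∂-⊛ : ∀ f g → ∂ (f ⊛ g) ≋ ((∂ f ⊛ g) ⊕ (f ⊛ ∂ g))
  ∂-⊛ f g n = begin
    ι N * sumTo (suc N) (λ k → f k * g (N ∸ k))    ≈⟨ sum-*ˡ (suc N) (ι N) _ ⟩
    sumTo (suc N) (λ k → ι N * (f k * g (N ∸ k)))  ≈⟨ sum-cong< (suc N) (λ k k≤N → split-weight (ℕP.≤-pred k≤N)) ⟩
    sumTo (suc N) (λ k → ι k * f k * g (N ∸ k) + f k * (ι (N ∸ k) * g (N ∸ k)))
                                                   ≈⟨ sum-+ (suc N) _ _ ⟩
    sumTo (suc N) (λ k → ι k * f k * g (N ∸ k)) + sumTo (suc N) (λ k → f k * (ι (N ∸ k) * g (N ∸ k)))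
                                                   ≈⟨ +-cong derivative-left derivative-right ⟩
    (∂ f ⊛ g) n + (f ⊛ ∂ g) n                      ∎
    where
    N = suc n
    split-weight : ∀ {k} → k ℕ.≤ N → ι N * (f k * g (N ∸ k)) ≈ ι k * f k * g (N ∸ k) + f k * (ι (N ∸ k) * g (N ∸ k))
    split-weight {k} k≤N = begin
      ι N * (f k * g (N ∸ k))                 ≈⟨ *-cong (≡-index ι (≡.sym (ℕP.m+[n∸m]≡n k≤N))) refl ⟩
      ι (k ℕ.+ (N ∸ k)) * (f k * g (N ∸ k))   ≈⟨ *-cong (ι-+ k (N ∸ k)) refl ⟩
      (ι k + ι (N ∸ k)) * (f k * g (N ∸ k))
        ≈⟨ solve 4 (λ a b u v → (a :+ b) :* (u :* v) := a :* u :* v :+ u :* (b :* v)) refl _ _ _ _ ⟩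
      ι k * f k * g (N ∸ k) + f k * (ι (N ∸ k) * g (N ∸ k)) ∎
    -- the k = 0 term vanishes; the others are (∂ f ⊛ g)_n
    derivative-left : sumTo (suc N) (λ k → ι k * f k * g (N ∸ k)) ≈ (∂ f ⊛ g) n
    derivative-left = begin
      sumTo (suc N) (λ k → ι k * f k * g (N ∸ k))           ≈⟨ sum-peel N _ ⟩
      0# * f 0 * g N + (∂ f ⊛ g) n                           ≈⟨ +-cong (trans (*-cong (zeroˡ _) refl) (zeroˡ _)) refl ⟩
      0# + (∂ f ⊛ g) n                                       ≈⟨ +-identityˡ _ ⟩
      (∂ f ⊛ g) n                                            ∎
    -- the k = N term vanishes; the others are (f ⊛ ∂ g)_n
    derivative-right : sumTo (suc N) (λ k → f k * (ι (N ∸ k) * g (N ∸ k))) ≈ (f ⊛ ∂ g) n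
    derivative-right = begin
      sumTo N (λ k → f k * (ι (N ∸ k) * g (N ∸ k))) + f N * (ι (N ∸ N) * g (N ∸ N))
        ≈⟨ +-cong (sum-cong< N (λ k k<N → *-cong refl (≡-index (λ j → ι j * g j) (ℕP.+-∸-assoc 1 (ℕP.≤-pred k<N)))))
                  (trans (*-cong refl (trans (*-cong (≡-index ι (ℕP.n∸n≡0 N)) refl) (zeroˡ _))) (zeroʳ _)) ⟩
      (f ⊛ ∂ g) n + 0#                                       ≈⟨ +-identityʳ _ ⟩
      (f ⊛ ∂ g) n                                            ∎

  ∂-exp : ∀ a → ∂ (expS a) ≋ scale a (expS a)
  ∂-exp a n = begin
    ι (suc n) * ((a * a ^ n) * invFact (suc n))
      ≈⟨ solve 4 (λ i u v w → i :* ((u :* v) :* w) := u :* (v :* (i :* w))) refl (ι (suc n)) a (a ^ n) _ ⟩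
    a * (a ^ n * (ι (suc n) * invFact (suc n)))  ≈⟨ *-cong refl (*-cong refl (invFact-suc n)) ⟩
    a * (a ^ n * invFact n)                      ∎

  exp-unique : ∀ {f a} → ∂ f ≋ scale a f → ∀ n → f n ≈ f 0 * expS a n
  exp-unique {f} {a} f′≋af zero    = sym (trans (*-cong refl (trans (*-identityˡ _) invFact-zero)) (*-identityʳ _))
  exp-unique {f} {a} f′≋af (suc n) = cancelˡ (char0 n) (begin
    ι (suc n) * f (suc n)                    ≈⟨ f′≋af n ⟩
    a * f n                                  ≈⟨ *-cong refl (exp-unique f′≋af n) ⟩
    a * (f 0 * expS a n)                     ≈⟨ solve 3 (λ u v w → u :* (v :* w) := v :* (u :* w)) refl a (f 0) _ ⟩
    f 0 * (a * expS a n)                     ≈⟨ *-cong refl (sym (∂-exp a n)) ⟩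
    f 0 * (ι (suc n) * expS a (suc n))       ≈⟨ solve 3 (λ u v w → u :* (v :* w) := v :* (u :* w)) refl (f 0) _ _ ⟩
    ι (suc n) * (f 0 * expS a (suc n))       ∎)

  exp-cong : ∀ {a b} → a ≈ b → expS a ≋ expS b
  exp-cong a≈b n = *-cong (pow-cong n a≈b) refl

  exp-zero : expS 0# ≋ one
  exp-zero zero    = trans (*-identityˡ _) invFact-zero
  exp-zero (suc n) = trans (*-cong (zeroˡ _) refl) (zeroˡ _)

  -- e^{at} e^{bt} = e^{(a+b)t}: the product solves f' = (a+b) f with f(0) = 1
  exp-add : ∀ a b → (expS a ⊛ expS b) ≋ expS (a + b)
  exp-add a b n = trans (exp-unique product′ n) (trans (*-cong product₀ refl) (*-identityˡ _))
    where
    product′ : ∂ (expS a ⊛ expS b) ≋ scale (a + b) (expS a ⊛ expS b)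
    product′ = ∂ (expS a ⊛ expS b)
                 ≋⟨ ∂-⊛ (expS a) (expS b) ⟩
               ((∂ (expS a) ⊛ expS b) ⊕ (expS a ⊛ ∂ (expS b)))
                 ≋⟨ (λ k → +-cong (trans (⊛-congˡ (expS b) (∂-exp a) k) (scale-⊛ a (expS a) (expS b) k))
                                  (trans (⊛-congʳ (expS a) (∂-exp b) k) (⊛-scale b (expS a) (expS b) k))) ⟩
               ((scale a (expS a ⊛ expS b)) ⊕ (scale b (expS a ⊛ expS b)))
                 ≋⟨ (λ k → sym (distribʳ _ _ _)) ⟩
               scale (a + b) (expS a ⊛ expS b) ≋∎
    product₀ : (expS a ⊛ expS b) 0 ≈ 1#
    product₀ = trans (+-identityˡ _) (trans (*-cong (exp-zero 0) (exp-zero 0)) (*-identityˡ _))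

  -- the dilation t ↦ c t, a ring endomorphism of power series
  dilate : Carrier → Series → Series
  dilate c f n = (c ^ n) * f n

  dilate-cong : ∀ c {f g} → f ≋ g → dilate c f ≋ dilate c g
  dilate-cong c f≋g n = *-cong refl (f≋g n)

  dilate-⊛ : ∀ c f g → dilate c (f ⊛ g) ≋ (dilate c f ⊛ dilate c g)
  dilate-⊛ c f g n = trans (sum-*ˡ (suc n) (c ^ n) _) (sum-cong< (suc n) (λ k k≤n → trans
    (*-cong (trans (≡-index (c ^_) (≡.sym (ℕP.m+[n∸m]≡n (ℕP.≤-pred k≤n)))) (pow-+ c k (n ∸ k))) refl)
    (solve 4 (λ a b u v → (a :* b) :* (u :* v) := (a :* u) :* (b :* v)) refl _ _ _ _)))

  dilate-⊕ : ∀ c f g → dilate c (f ⊕ g) ≋ (dilate c f ⊕ dilate c g)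
  dilate-⊕ c f g n = distribˡ _ _ _

  dilate-scale : ∀ c a f → dilate c (scale a f) ≋ scale a (dilate c f)
  dilate-scale c a f n = solve 3 (λ u v w → u :* (v :* w) := v :* (u :* w)) refl _ _ _

  dilate-one : ∀ c → dilate c one ≋ one
  dilate-one c zero    = *-identityʳ _
  dilate-one c (suc n) = zeroʳ _

  dilate-shift : ∀ c f → dilate c (shiftT f) ≋ scale c (shiftT (dilate c f))
  dilate-shift c f zero    = trans (zeroʳ _) (sym (zeroʳ _))
  dilate-shift c f (suc n) = *-assoc _ _ _

  dilate-exp : ∀ c a → dilate c (expS a) ≋ expS (c * a)
  dilate-exp c a n = trans (sym (*-assoc _ _ _)) (*-cong (sym (pow-* c a n)) refl)

  sub2-cong : ∀ {f g} → f ≋ g → sub2 f ≋ sub2 g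
  sub2-cong f≋g zero          = f≋g 0
  sub2-cong f≋g (suc zero)    = refl
  sub2-cong f≋g (suc (suc n)) = sub2-cong (λ k → f≋g (suc k)) n

  sub2-scale : ∀ a f → sub2 (scale a f) ≋ scale a (sub2 f)
  sub2-scale a f zero          = refl
  sub2-scale a f (suc zero)    = sym (zeroʳ a)
  sub2-scale a f (suc (suc n)) = sub2-scale a (λ k → f (suc k)) n

  dilate-sub2 : ∀ c f → dilate c (sub2 f) ≋ sub2 (dilate (c * c) f)
  dilate-sub2 c f zero          = refl
  dilate-sub2 c f (suc zero)    = zeroʳ _
  dilate-sub2 c f (suc (suc n)) = begin
    (c * (c * c ^ n)) * sub2 f′ n
      ≈⟨ solve 3 (λ a b u → (a :* (a :* b)) :* u := (a :* a) :* (b :* u)) refl c (c ^ n) _ ⟩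
    (c * c) * dilate c (sub2 f′) n                  ≈⟨ *-cong refl (dilate-sub2 c f′ n) ⟩
    (c * c) * sub2 (dilate (c * c) f′) n            ≈⟨ sym (sub2-scale (c * c) _ n) ⟩
    sub2 (scale (c * c) (dilate (c * c) f′)) n      ≈⟨ sub2-cong (λ k → sym (*-assoc _ _ _)) n ⟩
    sub2 (λ k → dilate (c * c) f (suc k)) n         ∎
    where
    f′ : Series
    f′ k = f (suc k)

  sub2-pairing : ∀ N (h u : Series) →
    sumTo (suc N) (λ k → sub2 h k * u k) ≈ sumTo (suc ⌊ N /2⌋) (λ s → h s * u (2 ℕ.* s))
  sub2-pairing zero          h u = refl
  sub2-pairing (suc zero)    h u = trans (+-cong refl (zeroˡ _)) (+-identityʳ _)
  sub2-pairing (suc (suc N)) h u = begin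
    sumTo (suc (suc (suc N))) (λ k → sub2 h k * u k)
      ≈⟨ trans (sum-peel (suc (suc N)) _) (+-cong refl (sum-peel (suc N) _)) ⟩
    h 0 * u 0 + (0# * u 1 + sumTo (suc N) (λ k → sub2 h′ k * u (suc (suc k))))
      ≈⟨ +-cong refl (trans (+-cong (zeroˡ _) refl) (+-identityˡ _)) ⟩
    h 0 * u 0 + sumTo (suc N) (λ k → sub2 h′ k * u (suc (suc k)))
      ≈⟨ +-cong refl (sub2-pairing N h′ (λ k → u (suc (suc k)))) ⟩
    h 0 * u 0 + sumTo (suc ⌊ N /2⌋) (λ s → h′ s * u (suc (suc (2 ℕ.* s))))
      ≈⟨ +-cong refl (sum-cong (suc ⌊ N /2⌋) (λ s → *-cong refl (≡-index u (≡.cong suc (≡.sym (ℕP.+-suc s (s ℕ.+ 0))))))) ⟩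
    h 0 * u 0 + sumTo (suc ⌊ N /2⌋) (λ s → h′ s * u (2 ℕ.* suc s))
      ≈⟨ sym (sum-peel (suc ⌊ N /2⌋) _) ⟩
    sumTo (suc (suc ⌊ N /2⌋)) (λ s → h s * u (2 ℕ.* s)) ∎
    where
    h′ : Series
    h′ k = h (suc k)

  numerator : Carrier → Carrier → Series
  numerator x y = scale (ι 2) (shiftT (expS x ⊛ sub2 (expS y)))

  numerator-cong : ∀ {x x′ y y′} → x ≈ x′ → y ≈ y′ → numerator x y ≋ numerator x′ y′
  numerator-cong x≈x′ y≈y′ = scale-cong refl (shift-cong (⊛-cong (exp-cong x≈x′) (sub2-cong (exp-cong y≈y′))))

  numerator-translate : ∀ a b y → (expS b ⊛ numerator a y) ≋ numerator (a + b) y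
  numerator-translate a b y =
    (expS b ⊛ numerator a y)                   ≋⟨ ⊛-scale (ι 2) (expS b) (shiftT (E ⊛ S)) ⟩
    scale (ι 2) (expS b ⊛ shiftT (E ⊛ S))      ≋⟨ scale-cong refl (≋-trans (⊛-comm (expS b) _) (shift-⊛ (E ⊛ S) (expS b))) ⟩
    scale (ι 2) (shiftT ((E ⊛ S) ⊛ expS b))    ≋⟨ scale-cong refl (shift-cong reorder) ⟩
    numerator (a + b) y                        ≋∎
    where
    E = expS a
    S = sub2 (expS y)
    reorder : ((E ⊛ S) ⊛ expS b) ≋ (expS (a + b) ⊛ S)
    reorder = ((E ⊛ S) ⊛ expS b)   ≋⟨ ⊛-assoc E S (expS b) ⟩
              (E ⊛ (S ⊛ expS b))   ≋⟨ ⊛-congʳ E (⊛-comm S (expS b)) ⟩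
              (E ⊛ (expS b ⊛ S))   ≋⟨ ≋-sym (⊛-assoc E (expS b) S) ⟩
              ((E ⊛ expS b) ⊛ S)   ≋⟨ ⊛-congˡ S (exp-add a b) ⟩
              (expS (a + b) ⊛ S)   ≋∎

  dilate-numerator : ∀ c x y → dilate c (numerator x y) ≋ scale c (numerator (c * x) ((c * c) * y))
  dilate-numerator c x y =
    dilate c (numerator x y)                                    ≋⟨ dilate-scale c (ι 2) _ ⟩
    scale (ι 2) (dilate c (shiftT (expS x ⊛ sub2 (expS y))))    ≋⟨ scale-cong refl (dilate-shift c _) ⟩
    scale (ι 2) (scale c (shiftT (dilate c (expS x ⊛ sub2 (expS y)))))
      ≋⟨ scale-cong refl (scale-cong refl (shift-cong (≋-trans (dilate-⊛ c (expS x) (sub2 (expS y)))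
           (⊛-cong {g′ = sub2 (expS ((c * c) * y))} (dilate-exp c x)
             (≋-trans (dilate-sub2 c (expS y)) (sub2-cong (dilate-exp (c * c) y))))))) ⟩
    scale (ι 2) (scale c (shiftT (expS (c * x) ⊛ sub2 (expS ((c * c) * y)))))
                                                                ≋⟨ scale-swap (ι 2) c _ ⟩
    scale c (numerator (c * x) ((c * c) * y))                   ≋∎

  HG-egf : ∀ (G : Carrier → Carrier → ℕ → Carrier) x y λ′ →
    egf (HG G x y λ′) ≋ (egf (G x λ′) ⊛ sub2 (expS y))
  HG-egf G x y λ′ n = begin
    (ι (n !) * S) * invFact n                     ≈⟨ solve 3 (λ a b u → (a :* b) :* u := b :* (a :* u)) refl _ _ _ ⟩
    S * (ι (n !) * invFact n)                     ≈⟨ trans (*-cong refl (invFact-inverse n)) (*-identityʳ _) ⟩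
    S                                             ≈⟨ sum-cong (suc ⌊ n /2⌋) term ⟩
    sumTo (suc ⌊ n /2⌋) (λ s → expS y s * egf g (n ∸ 2 ℕ.* s))
                                                  ≈⟨ sym (sub2-pairing n (expS y) (λ k → egf g (n ∸ k))) ⟩
    (sub2 (expS y) ⊛ egf g) n                     ≈⟨ ⊛-comm (sub2 (expS y)) (egf g) n ⟩
    (egf g ⊛ sub2 (expS y)) n                     ∎
    where
    g = G x λ′
    S = sumTo (suc ⌊ n /2⌋) (λ s → (y ^ s) * g (n ∸ 2 ℕ.* s) * (ι (s ! ℕ.* (n ∸ 2 ℕ.* s) !) ⁻¹))
    term : ∀ s → (y ^ s) * g (n ∸ 2 ℕ.* s) * (ι (s ! ℕ.* (n ∸ 2 ℕ.* s) !) ⁻¹)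
                 ≈ expS y s * egf g (n ∸ 2 ℕ.* s)
    term s = trans (*-cong refl (invFact-product s (n ∸ 2 ℕ.* s)))
      (solve 4 (λ a b u v → (a :* b) :* (u :* v) := (a :* u) :* (b :* v)) refl _ _ _ _)

  HG-isAG2 : ∀ (G : Carrier → Carrier → ℕ → Carrier) x y λ′ →
    IsAG x λ′ (G x λ′) → IsAG2 x y λ′ (HG G x y λ′)
  HG-isAG2 G x y λ′ isAG =
    (den λ′ ⊛ egf (HG G x y λ′))                        ≋⟨ ⊛-congʳ (den λ′) (HG-egf G x y λ′) ⟩
    (den λ′ ⊛ (egf (G x λ′) ⊛ S))                       ≋⟨ ≋-sym (⊛-assoc (den λ′) _ S) ⟩
    ((den λ′ ⊛ egf (G x λ′)) ⊛ S)                       ≋⟨ ⊛-congˡ S isAG ⟩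
    (scale (ι 2) (shiftT (expS x)) ⊛ S)                 ≋⟨ scale-⊛ (ι 2) _ S ⟩
    scale (ι 2) (shiftT (expS x) ⊛ S)                   ≋⟨ scale-cong refl (shift-⊛ (expS x) S) ⟩
    numerator x y                                       ≋∎
    where
    S = sub2 (expS y)

  +-solve : ∀ {x y z} → x + y ≈ z → x ≈ z + - y
  +-solve {x} {y} {z} x+y≈z = begin
    x                ≈⟨ sym (+-identityʳ x) ⟩
    x + 0#           ≈⟨ +-cong refl (sym (-‿inverseʳ y)) ⟩
    x + (y + - y)    ≈⟨ sym (+-assoc _ _ _) ⟩
    (x + y) + - y    ≈⟨ +-cong x+y≈z refl ⟩
    z + - y          ∎

  weight : Carrier → ℕ → Carrier
  weight a k = (a ^ k) * ((- 1#) ^ k)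

  weight-step : ∀ a k → weight a k * a + weight a (suc k) ≈ 0#
  weight-step a k = begin
    w * a + (a * a ^ k) * (- 1# * (- 1#) ^ k)  ≈⟨ +-cong refl (*-cong refl (-1*x≈-x _)) ⟩
    w * a + (a * a ^ k) * - (- 1#) ^ k         ≈⟨ +-cong refl (sym (-‿distribʳ-* _ _)) ⟩
    w * a + - ((a * a ^ k) * (- 1#) ^ k)       ≈⟨ +-cong refl (-‿cong (solve 3 (λ u v z → (u :* v) :* z := (v :* z) :* u) refl a (a ^ k) _)) ⟩
    w * a + - (w * a)                          ≈⟨ -‿inverseʳ _ ⟩
    0#                                         ∎
    where
    w = weight a k

  weight-odd : ∀ a {m} → Odd m → - weight a m ≈ a ^ m
  weight-odd a {m} odd = begin
    - (a ^ m * (- 1#) ^ m)   ≈⟨ -‿cong (*-cong refl (minus-one-odd odd)) ⟩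
    - (a ^ m * - 1#)         ≈⟨ -‿cong (sym (-‿distribʳ-* _ _)) ⟩
    - - (a ^ m * 1#)         ≈⟨ -‿involutive _ ⟩
    a ^ m * 1#               ≈⟨ *-identityʳ _ ⟩
    a ^ m                    ∎

  geometric-sum : ∀ a m → (sumS m (λ k → scale (weight a k) (expS (ι k))) ⊛ den a)
                            ≋ (scale (- weight a m) (expS (ι m)) ⊕ one)
  geometric-sum a m n = begin
    (sumS m E ⊛ den a) n                     ≈⟨ sumS-⊛ m E (den a) n ⟩
    sumTo m (λ k → (E k ⊛ den a) n)          ≈⟨ sum-cong m term ⟩
    sumTo m (λ k → v k + u k)                ≈⟨ +-solve (telescope m u v cancels) ⟩
    u 0 + - u m                              ≈⟨ +-cong first (-‿distribˡ-* _ _) ⟩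
    one n + - weight a m * expS (ι m) n      ≈⟨ +-comm _ _ ⟩
    - weight a m * expS (ι m) n + one n      ∎
    where
    E : ℕ → Series
    E k = scale (weight a k) (expS (ι k))
    u v : ℕ → Carrier
    u k = weight a k * expS (ι k) n
    v k = (weight a k * a) * expS (ι (suc k)) n
    exp-step : ∀ k → (expS (ι k) ⊛ expS 1#) ≋ expS (ι (suc k))
    exp-step k = ≋-trans (exp-add (ι k) 1#) (exp-cong (+-comm _ _))
    term : ∀ k → (E k ⊛ den a) n ≈ v k + u k
    term k = begin
      (E k ⊛ den a) n                                       ≈⟨ ⊛-⊕ (scale a (expS 1#)) one (E k) n ⟩
      (E k ⊛ scale a (expS 1#)) n + (E k ⊛ one) n           ≈⟨ +-cong (⊛-scale a (E k) (expS 1#) n) (⊛-one (E k) n) ⟩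
      a * (E k ⊛ expS 1#) n + u k                           ≈⟨ +-cong (*-cong refl (scale-⊛ (weight a k) (expS (ι k)) (expS 1#) n)) refl ⟩
      a * (weight a k * (expS (ι k) ⊛ expS 1#) n) + u k     ≈⟨ +-cong (*-cong refl (*-cong refl (exp-step k n))) refl ⟩
      a * (weight a k * expS (ι (suc k)) n) + u k
        ≈⟨ +-cong (solve 3 (λ x w e → x :* (w :* e) := (w :* x) :* e) refl a (weight a k) _) refl ⟩
      v k + u k                                             ∎
    cancels : ∀ k → v k + u (suc k) ≈ 0#
    cancels k = trans (sym (distribʳ _ _ _)) (trans (*-cong (weight-step a k) refl) (zeroˡ _))
    first : u 0 ≈ one n
    first = trans (*-cong (*-identityˡ _) refl) (trans (*-identityˡ _) (exp-zero n))

  dilate-den : ∀ c a → dilate c (den a) ≋ (scale a (expS c) ⊕ one)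
  dilate-den c a n = trans (dilate-⊕ c (scale a (expS 1#)) one n) (+-cong
    (trans (dilate-scale c a (expS 1#) n) (*-cong refl (trans (dilate-exp c 1# n) (exp-cong (*-identityʳ c) n))))
    (dilate-one c n))

  geometric-odd : ∀ a {m} → Odd m → (sumS m (λ k → scale (weight a k) (expS (ι k))) ⊛ den a)
                                      ≋ dilate (ι m) (den (a ^ m))
  geometric-odd a {m} odd n = trans (geometric-sum a m n)
    (trans (+-cong (*-cong (weight-odd a odd) refl) refl) (sym (dilate-den (ι m) (a ^ m) n)))

  -- a series d is cancellable as soon as d ⊛ h = c t for some h and some c ≠ 0:
  -- multiplying d ⊛ f = d ⊛ g by h gives c t f = c t g
  cancel-annihilated : ∀ {d h c} → ¬ (c ≈ 0#) → (d ⊛ h) ≋ scale c (shiftT one) →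
                       ∀ {f g} → (d ⊛ f) ≋ (d ⊛ g) → f ≋ g
  cancel-annihilated {d} {h} {c} c≉0 annihilates {f} {g} df≋dg n =
    cancelˡ c≉0 (trans (reduce f (suc n)) (trans (⊛-congʳ h df≋dg (suc n)) (sym (reduce g (suc n)))))
    where
    reduce : ∀ f → scale c (shiftT f) ≋ (h ⊛ (d ⊛ f))
    reduce f =
      scale c (shiftT f)           ≋⟨ scale-cong refl (shift-cong (≋-sym (one-⊛ f))) ⟩
      scale c (shiftT (one ⊛ f))   ≋⟨ scale-cong refl (≋-sym (shift-⊛ one f)) ⟩
      scale c (shiftT one ⊛ f)     ≋⟨ ≋-sym (scale-⊛ c (shiftT one) f) ⟩
      (scale c (shiftT one) ⊛ f)   ≋⟨ ⊛-congˡ f (≋-trans (≋-sym annihilates) (⊛-comm d h)) ⟩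
      ((h ⊛ d) ⊛ f)                ≋⟨ ⊛-assoc h d f ⟩
      (h ⊛ (d ⊛ f))                ≋∎

  dilation-coefficients : ∀ {m} {a b : ℕ → Carrier} → ¬ (ι m ≈ 0#) →
    dilate (ι m) (egf b) ≋ scale (ι m) (egf a) → ∀ n → a n ≈ mPow m n * b n
  dilation-coefficients {m} {a} {b} m≉0 b≋a = coefficient
    where
    M = ι m
    same : ∀ n → M ^ n * b n ≈ M * a n
    same n = cancelˡ (invFact-nonzero n) (begin
      invFact n * (M ^ n * b n)    ≈⟨ solve 3 (λ u v w → u :* (v :* w) := v :* (w :* u)) refl _ _ _ ⟩
      M ^ n * (b n * invFact n)    ≈⟨ b≋a n ⟩
      M * (a n * invFact n)        ≈⟨ solve 3 (λ u v w → u :* (v :* w) := w :* (u :* v)) refl _ _ _ ⟩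
      invFact n * (M * a n)        ∎)
    coefficient : ∀ n → a n ≈ mPow m n * b n
    coefficient zero    = cancelˡ m≉0 (begin
      M * a 0                   ≈⟨ sym (same 0) ⟩
      1# * b 0                  ≈⟨ *-cong (sym (inverse M m≉0)) refl ⟩
      (M * M ⁻¹) * b 0          ≈⟨ *-assoc _ _ _ ⟩
      M * (M ⁻¹ * b 0)          ∎)
    coefficient (suc n) = cancelˡ m≉0 (trans (sym (same (suc n))) (*-assoc _ _ _))

  module Multiplication
    (G : Carrier → Carrier → ℕ → Carrier) (isAG : ∀ x λ′ → IsAG x λ′ (G x λ′))
    (G₂ : Carrier → Carrier → Carrier → ℕ → Carrier) (isAG2 : ∀ x y λ′ → IsAG2 x y λ′ (G₂ x y λ′))
    (m : ℕ) (odd : Odd m) (x y p λ′ : Carrier)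
    where

    M Λ Y : Carrier
    M = ι m
    Λ = λ′ ^ m
    Y = (p * y) * ((ι m ^ 2) ⁻¹)

    M≉0 : ¬ (M ≈ 0#)
    M≉0 = odd-nonzero odd

    H : ℕ → ℕ → Carrier
    H k = HG G (x + ι k * (M ⁻¹)) Y Λ

    lhs rhs : ℕ → Carrier
    lhs = G₂ (M * x) (p * y) λ′
    rhs n = sumTo m (λ k → (λ′ ^ k) * ((- 1#) ^ k) * H k n)

    -- 2t e^{mxt + pyt²},  Σ_{k<m} (-λ)^k e^{kt}  and  λ^m e^{mt} + 1
    N P Dm : Series
    N  = numerator (M * x) (p * y)
    P  = sumS m (λ k → scale (weight λ′ k) (expS (ι k)))
    Dm = dilate M (den Λ)

    M-shifted : ∀ k → M * (x + ι k * M ⁻¹) ≈ M * x + ι k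
    M-shifted k = begin
      M * (x + ι k * M ⁻¹)        ≈⟨ solve 4 (λ a u i b → a :* (u :+ i :* b) := a :* u :+ i :* (a :* b)) refl M x (ι k) (M ⁻¹) ⟩
      M * x + ι k * (M * M ⁻¹)    ≈⟨ +-cong refl (trans (*-cong refl (inverse M M≉0)) (*-identityʳ _)) ⟩
      M * x + ι k                 ∎

    M²Y : (M * M) * Y ≈ p * y
    M²Y = begin
      (M * M) * ((p * y) * (M ^ 2) ⁻¹)
        ≈⟨ solve 3 (λ a q r → (a :* a) :* (q :* r) := q :* ((a :* (a :* con 1)) :* r)) refl M (p * y) _ ⟩
      (p * y) * ((M ^ 2) * (M ^ 2) ⁻¹)   ≈⟨ *-cong refl (inverse _ (nonzero-* M≉0 (nonzero-* M≉0 1≉0))) ⟩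
      (p * y) * 1#                       ≈⟨ *-identityʳ _ ⟩
      p * y                              ∎

    H-equation : ∀ k → (Dm ⊛ dilate M (egf (H k))) ≋ scale M (expS (ι k) ⊛ N)
    H-equation k =
      (Dm ⊛ dilate M (egf (H k)))          ≋⟨ ≋-sym (dilate-⊛ M (den Λ) (egf (H k))) ⟩
      dilate M (den Λ ⊛ egf (H k))         ≋⟨ dilate-cong M (HG-isAG2 G xk Y Λ (isAG xk Λ)) ⟩
      dilate M (numerator xk Y)            ≋⟨ dilate-numerator M xk Y ⟩
      scale M (numerator (M * xk) ((M * M) * Y))
                                           ≋⟨ scale-cong refl (numerator-cong (M-shifted k) M²Y) ⟩
      scale M (numerator (M * x + ι k) (p * y))
                                           ≋⟨ scale-cong refl (≋-sym (numerator-translate (M * x) (ι k) (p * y))) ⟩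
      scale M (expS (ι k) ⊛ N)             ≋∎
      where
      xk = x + ι k * M ⁻¹

    rhs-expand : dilate M (egf rhs) ≋ sumS m (λ k → scale (weight λ′ k) (dilate M (egf (H k))))
    rhs-expand n = begin
      M ^ n * (sumTo m (λ k → weight λ′ k * H k n) * invFact n)
        ≈⟨ trans (*-cong refl (sum-*ʳ m _ _)) (sum-*ˡ m _ _) ⟩
      sumTo m (λ k → M ^ n * (weight λ′ k * H k n * invFact n))
        ≈⟨ sum-cong m (λ k → solve 4 (λ a w h i → a :* (w :* h :* i) := w :* (a :* (h :* i))) refl _ _ _ _) ⟩
      sumTo m (λ k → weight λ′ k * (M ^ n * (H k n * invFact n))) ∎

    rhs-equation : (Dm ⊛ dilate M (egf rhs)) ≋ scale M (P ⊛ N)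
    rhs-equation =
      (Dm ⊛ dilate M (egf rhs))                             ≋⟨ ⊛-congʳ Dm rhs-expand ⟩
      (Dm ⊛ sumS m (λ k → scale (w k) (dilate M (egf (H k))))) ≋⟨ ⊛-comm Dm _ ⟩
      (sumS m (λ k → scale (w k) (dilate M (egf (H k)))) ⊛ Dm) ≋⟨ sumS-⊛ m _ Dm ⟩
      sumS m (λ k → scale (w k) (dilate M (egf (H k))) ⊛ Dm)   ≋⟨ sumS-cong m weighted ⟩
      sumS m (λ k → scale M (scale (w k) (expS (ι k)) ⊛ N))    ≋⟨ ≋-sym (sumS-scale m M _) ⟩
      scale M (sumS m (λ k → scale (w k) (expS (ι k)) ⊛ N))    ≋⟨ scale-cong refl (≋-sym (sumS-⊛ m _ N)) ⟩
      scale M (P ⊛ N)                                          ≋∎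
      where
      w = weight λ′
      weighted : ∀ k → (scale (w k) (dilate M (egf (H k))) ⊛ Dm) ≋ scale M (scale (w k) (expS (ι k)) ⊛ N)
      weighted k =
        (scale (w k) (dilate M (egf (H k))) ⊛ Dm)   ≋⟨ scale-⊛ (w k) _ Dm ⟩
        scale (w k) (dilate M (egf (H k)) ⊛ Dm)     ≋⟨ scale-cong refl (≋-trans (⊛-comm _ Dm) (H-equation k)) ⟩
        scale (w k) (scale M (expS (ι k) ⊛ N))      ≋⟨ scale-swap (w k) M _ ⟩
        scale M (scale (w k) (expS (ι k) ⊛ N))      ≋⟨ scale-cong refl (≋-sym (scale-⊛ (w k) (expS (ι k)) N)) ⟩
        scale M (scale (w k) (expS (ι k)) ⊛ N)      ≋∎

    -- by the geometric identity Dm = P (λe^t + 1), and (λe^t + 1) Σ lhs_n t^n/n! = N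
    lhs-equation : (Dm ⊛ scale M (egf lhs)) ≋ scale M (P ⊛ N)
    lhs-equation =
      (Dm ⊛ scale M (egf lhs))             ≋⟨ ⊛-congˡ (scale M (egf lhs)) (≋-sym (geometric-odd λ′ odd)) ⟩
      ((P ⊛ den λ′) ⊛ scale M (egf lhs))   ≋⟨ ⊛-assoc P (den λ′) (scale M (egf lhs)) ⟩
      (P ⊛ (den λ′ ⊛ scale M (egf lhs)))   ≋⟨ ⊛-congʳ P (⊛-scale M (den λ′) (egf lhs)) ⟩
      (P ⊛ scale M (den λ′ ⊛ egf lhs))     ≋⟨ ⊛-congʳ P (scale-cong refl (isAG2 (M * x) (p * y) λ′)) ⟩
      (P ⊛ scale M N)                      ≋⟨ ⊛-scale M P N ⟩
      scale M (P ⊛ N)                      ≋∎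

    Dm-annihilated : (Dm ⊛ dilate M (egf (G 0# Λ))) ≋ scale (ι 2 * M) (shiftT one)
    Dm-annihilated =
      (Dm ⊛ dilate M (egf (G 0# Λ)))                  ≋⟨ ≋-sym (dilate-⊛ M (den Λ) (egf (G 0# Λ))) ⟩
      dilate M (den Λ ⊛ egf (G 0# Λ))                 ≋⟨ dilate-cong M (isAG 0# Λ) ⟩
      dilate M (scale (ι 2) (shiftT (expS 0#)))       ≋⟨ dilate-scale M (ι 2) _ ⟩
      scale (ι 2) (dilate M (shiftT (expS 0#)))       ≋⟨ scale-cong refl (dilate-shift M _) ⟩
      scale (ι 2) (scale M (shiftT (dilate M (expS 0#))))
        ≋⟨ scale-cong refl (scale-cong refl (shift-cong (≋-trans (dilate-cong M exp-zero) (dilate-one M)))) ⟩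
      scale (ι 2) (scale M (shiftT one))              ≋⟨ scale-scale (ι 2) M _ ⟩
      scale (ι 2 * M) (shiftT one)                    ≋∎

    dilated-identity : dilate M (egf rhs) ≋ scale M (egf lhs)
    dilated-identity = cancel-annihilated {h = dilate M (egf (G 0# Λ))} (nonzero-* (ι-nonzero 2) M≉0) Dm-annihilated
                         (≋-trans rhs-equation (≋-sym lhs-equation))

theorem4p1 : ∀ {c ℓ} (F : Char0Field c ℓ) →
  let open Char0Field F
      open Over F
  in (G : Carrier → Carrier → ℕ → Carrier) →
     (∀ x λ' → IsAG x λ' (G x λ')) →
     (G₂ : Carrier → Carrier → Carrier → ℕ → Carrier) →
     (∀ x y λ' → IsAG2 x y λ' (G₂ x y λ')) →
     (m : ℕ) → Odd m →
     (x y p λ' : Carrier) → (n : ℕ) →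
     G₂ (ι m * x) (p * y) λ' n
       ≈ mPow m n * sumTo m (λ k →
           (λ' ^ k) * ((- 1#) ^ k)
             * HG G (x + ι k * (ι m ⁻¹)) ((p * y) * ((ι m ^ 2) ⁻¹)) (λ' ^ m) n)
theorem4p1 F G isAG G₂ isAG2 m odd x y p λ′ n = dilation-coefficients M≉0 dilated-identity n
  where
  open Proof F
  open Multiplication G isAG G₂ isAG2 m odd x y p λ′
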